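{- Let $q$ be a prime power, let $1\le t,t'\le q$, and let $1\le\alpha_1\le\dots\le\alpha_t$ and $1\le\beta_1\le\dots\le\beta_{t'}$ be integers such that \[\sum_{i=1}^t(q^{\alpha_i}-1)=\sum_{i=1}^{t'}(q^{\beta_i}-1).\] Then $t=t'$ and $\alpha_i=\beta_i$ for all $i=1,\dots,t$. -}

module Defs where

open import Data.Nat using (ℕ; zero; suc; _+_; _∸_; _^_; _≤_)
open import Data.Nat.Primality using (Prime)
open import Data.Fin using (Fin; zero; suc)
open import Data.Product using (Σ; ∃; _×_)
open import Relation.Binary.PropositionalEquality using (_≡_)

IsPrimePower : ℕ → Set
IsPrimePower q = ∃ λ p → ∃ λ k → Prime p × 1 ≤ k × q ≡ p ^ k

sumFin : (t : ℕ) → (Fin t → ℕ) → ℕ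
sumFin zero    f = 0
sumFin (suc t) f = f zero + sumFin t (λ i → f (suc i))

S : ℕ → (t : ℕ) → (Fin t → ℕ) → ℕ
S q t α = sumFin t (λ i → q ^ α i ∸ 1)

{-# OPTIONS --safe #-}
-- Since every αᵢ ≥ 1, S + t = Σ q^αᵢ is divisible by q; so t ≡ t′ (mod q), and
-- 1 ≤ t, t′ ≤ q forces t = t′. Then Σ q^αᵢ = Σ q^βᵢ. With t ≤ q terms the top
-- exponents agree: a sorted sum with top exponent a is at most t·q^a < q^(a+1) + (t−1),
-- while a sum with a larger top exponent is at least q^(a+1) + (t−1). Cancelling the
-- top terms and inducting on t gives the remaining exponents.
module Submission where

open import Defs
open import Data.Nat using (ℕ; _≤_)
open import Data.Fin using (Fin; cast) renaming (_≤_ to _≤ᶠ_)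
open import Data.Product using (Σ)
open import Relation.Binary.PropositionalEquality using (_≡_)

open import Data.Nat using (zero; suc; _+_; _*_; _∸_; _^_; _<_; z<s; NonZero; >-nonZero; nonTrivial⇒n>1)
open import Data.Nat.Properties
open import Data.Nat.Divisibility using (_∣_; _∣0; m∣m*n; ∣m∣n⇒∣m+n; ∣m+n∣m⇒∣n; >⇒∤)
open import Data.Nat.Primality using (prime⇒nonZero; prime⇒nonTrivial)
open import Data.Fin using (fromℕ; inject₁) renaming (zero to fzero; suc to fsuc)
open import Data.Fin.Properties using (≤fromℕ; toℕ-inject₁; cast-is-id)
open import Data.Fin.Relation.Unary.Top using (view; ‵fromℕ; ‵inject₁)
open import Data.Product using (_,_)
open import Data.Sum using (inj₁; inj₂)
open import Function using (_∘_)
open import Relation.Binary.Definitions using (tri<; tri≈; tri>)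
open import Relation.Binary.PropositionalEquality using (refl; sym; trans; cong; cong₂; subst; subst₂; module ≡-Reasoning)
open import Relation.Nullary using (contradiction)

Sorted : ∀ {n} → (Fin n → ℕ) → Set
Sorted {n} α = (i j : Fin n) → i ≤ᶠ j → α i ≤ α j

Sorted-init : ∀ {n} {α : Fin (suc n) → ℕ} → Sorted α → Sorted (α ∘ inject₁)
Sorted-init α↑ i j i≤j =
  α↑ (inject₁ i) (inject₁ j) (subst₂ _≤_ (sym (toℕ-inject₁ i)) (sym (toℕ-inject₁ j)) i≤j)

sumFin-init-last : ∀ n (f : Fin (suc n) → ℕ) →
                   sumFin (suc n) f ≡ sumFin n (f ∘ inject₁) + f (fromℕ n)
sumFin-init-last zero    f = +-comm (f fzero) 0
sumFin-init-last (suc n) f = begin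
  f fzero + sumFin (suc n) (f ∘ fsuc)                                ≡⟨ cong (f fzero +_) (sumFin-init-last n (f ∘ fsuc)) ⟩
  f fzero + (sumFin n (f ∘ fsuc ∘ inject₁) + f (fsuc (fromℕ n)))     ≡⟨ +-assoc (f fzero) _ _ ⟨
  f fzero + sumFin n (f ∘ fsuc ∘ inject₁) + f (fsuc (fromℕ n))       ∎
  where open ≡-Reasoning

sumFin-cancel-last : ∀ n (f g : Fin (suc n) → ℕ) → f (fromℕ n) ≡ g (fromℕ n) →
                     sumFin (suc n) f ≡ sumFin (suc n) g →
                     sumFin n (f ∘ inject₁) ≡ sumFin n (g ∘ inject₁)
sumFin-cancel-last n f g last≡ sum≡ = +-cancelʳ-≡ (f (fromℕ n)) _ _ (begin
  sumFin n (f ∘ inject₁) + f (fromℕ n)  ≡⟨ sumFin-init-last n f ⟨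
  sumFin (suc n) f                      ≡⟨ sum≡ ⟩
  sumFin (suc n) g                      ≡⟨ sumFin-init-last n g ⟩
  sumFin n (g ∘ inject₁) + g (fromℕ n)  ≡⟨ cong (sumFin n (g ∘ inject₁) +_) last≡ ⟨
  sumFin n (g ∘ inject₁) + f (fromℕ n)  ∎)
  where open ≡-Reasoning

sumFin≤n*m : ∀ n {f : Fin n → ℕ} {m} → (∀ i → f i ≤ m) → sumFin n f ≤ n * m
sumFin≤n*m zero    f≤m = ≤-refl
sumFin≤n*m (suc n) f≤m = +-mono-≤ (f≤m fzero) (sumFin≤n*m n (f≤m ∘ fsuc))

n≤sumFin : ∀ n {f : Fin n → ℕ} → (∀ i → 1 ≤ f i) → n ≤ sumFin n f
n≤sumFin zero    f≥1 = ≤-refl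
n≤sumFin (suc n) f≥1 = +-mono-≤ (f≥1 fzero) (n≤sumFin n (f≥1 ∘ fsuc))

sumFin-∸1 : ∀ n {f : Fin n → ℕ} → (∀ i → 1 ≤ f i) → sumFin n (λ i → f i ∸ 1) + n ≡ sumFin n f
sumFin-∸1 zero    f≥1 = refl
sumFin-∸1 (suc n) {f} f≥1 = begin
  (f fzero ∸ 1 + Σ∸1) + suc n    ≡⟨ +-suc _ n ⟩
  suc ((f fzero ∸ 1 + Σ∸1) + n)  ≡⟨ cong suc (+-assoc (f fzero ∸ 1) Σ∸1 n) ⟩
  suc (f fzero ∸ 1) + (Σ∸1 + n)  ≡⟨ cong₂ _+_ (m+[n∸m]≡n (f≥1 fzero)) (sumFin-∸1 n (f≥1 ∘ fsuc)) ⟩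
  f fzero + sumFin n (f ∘ fsuc)  ∎
  where
    open ≡-Reasoning
    Σ∸1 = sumFin n (λ i → f (fsuc i) ∸ 1)

∣sumFin : ∀ n {d} {f : Fin n → ℕ} → (∀ i → d ∣ f i) → d ∣ sumFin n f
∣sumFin zero    {d} d∣f = d ∣0
∣sumFin (suc n)     d∣f = ∣m∣n⇒∣m+n (d∣f fzero) (∣sumFin n (d∣f ∘ fsuc))

[1+n]*x<q*x+n : ∀ {q n} x .{{_ : NonZero x}} → 1 < q → n < q → suc n * x < q * x + n
[1+n]*x<q*x+n {n = zero}  x 1<q _   = <-≤-trans (*-monoˡ-< x 1<q) (m≤m+n _ 0)
[1+n]*x<q*x+n {n = suc n} x _   n<q = ≤-<-trans (*-monoˡ-≤ x n<q) (m<m+n _ z<s)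

∣-gap⇒≡0 : ∀ {q m d} → q ∣ m → q ∣ m + d → d < q → d ≡ 0
∣-gap⇒≡0 {d = zero}  _   _     _   = refl
∣-gap⇒≡0 {d = suc _} q∣m q∣m+d d<q = contradiction (∣m+n∣m⇒∣n q∣m+d q∣m) (>⇒∤ d<q)

∣-offset-unique-≤ : ∀ {q m t t′} → q ∣ m + t → q ∣ m + t′ → 1 ≤ t → t′ ≤ q → t ≤ t′ → t ≡ t′
∣-offset-unique-≤ {q} {m} {t} q∣m+t q∣m+t′ 1≤t t′≤q t≤t′ with m≤n⇒∃[o]m+o≡n t≤t′
... | d , refl = sym (trans (cong (t +_) d≡0) (+-identityʳ t))
  where
    d≡0 : d ≡ 0
    d≡0 = ∣-gap⇒≡0 q∣m+t (subst (q ∣_) (sym (+-assoc m t d)) q∣m+t′)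
                        (≤-trans (+-monoˡ-≤ d 1≤t) t′≤q)

∣-offset-unique : ∀ {q m t t′} → q ∣ m + t → q ∣ m + t′ →
                  1 ≤ t → t ≤ q → 1 ≤ t′ → t′ ≤ q → t ≡ t′
∣-offset-unique {t = t} {t′} q∣m+t q∣m+t′ 1≤t t≤q 1≤t′ t′≤q with ≤-total t t′
... | inj₁ t≤t′ = ∣-offset-unique-≤ q∣m+t q∣m+t′ 1≤t t′≤q t≤t′
... | inj₂ t′≤t = sym (∣-offset-unique-≤ q∣m+t′ q∣m+t 1≤t′ t≤q t′≤t)

module PowerSums {q : ℕ} (1<q : 1 < q) where

  private instance
    q≢0 : NonZero q
    q≢0 = >-nonZero (<-trans z<s 1<q)

  powerSum : ∀ {n} → (Fin n → ℕ) → ℕ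
  powerSum {n} α = sumFin n (λ i → q ^ α i)

  S+n≡powerSum : ∀ n (α : Fin n → ℕ) → S q n α + n ≡ powerSum α
  S+n≡powerSum n α = sumFin-∸1 n (λ i → m^n>0 q (α i))

  ∣S+n : ∀ n {α : Fin n → ℕ} → (∀ i → 1 ≤ α i) → q ∣ S q n α + n
  ∣S+n n {α} α≥1 = subst (q ∣_) (sym (S+n≡powerSum n α)) (∣sumFin n (λ i → q∣q^ (α≥1 i)))
    where
      q∣q^ : ∀ {k} → 1 ≤ k → q ∣ q ^ k
      q∣q^ {suc k} _ = m∣m*n (q ^ k)

  powerSum-<-by-last : ∀ n (α β : Fin (suc n) → ℕ) → suc n ≤ q → Sorted α →
                       α (fromℕ n) < β (fromℕ n) → powerSum α < powerSum β
  powerSum-<-by-last n α β n<q α↑ a<b = begin-strict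
    powerSum α                      ≤⟨ sumFin≤n*m (suc n) (λ i → ^-monoʳ-≤ q (α↑ i (fromℕ n) (≤fromℕ i))) ⟩
    suc n * q ^ a                   <⟨ [1+n]*x<q*x+n (q ^ a) {{m^n≢0 q a}} 1<q n<q ⟩
    q ^ suc a + n                   ≤⟨ +-mono-≤ (^-monoʳ-≤ q a<b) (n≤sumFin n (λ i → m^n>0 q (β (inject₁ i)))) ⟩
    q ^ b + powerSum (β ∘ inject₁)  ≡⟨ +-comm (q ^ b) _ ⟩
    powerSum (β ∘ inject₁) + q ^ b  ≡⟨ sumFin-init-last n (λ i → q ^ β i) ⟨
    powerSum β                      ∎
    where
      open ≤-Reasoning
      a = α (fromℕ n)
      b = β (fromℕ n)

  powerSum-last-unique : ∀ n (α β : Fin (suc n) → ℕ) → suc n ≤ q → Sorted α → Sorted β →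
                         powerSum α ≡ powerSum β → α (fromℕ n) ≡ β (fromℕ n)
  powerSum-last-unique n α β n<q α↑ β↑ sum≡ with <-cmp (α (fromℕ n)) (β (fromℕ n))
  ... | tri< a<b _ _ = contradiction sum≡ (<⇒≢ (powerSum-<-by-last n α β n<q α↑ a<b))
  ... | tri≈ _ a≡b _ = a≡b
  ... | tri> _ _ b<a = contradiction (sym sum≡) (<⇒≢ (powerSum-<-by-last n β α n<q β↑ b<a))

  powerSum-injective : ∀ n → n ≤ q → (α β : Fin n → ℕ) → Sorted α → Sorted β →
                       powerSum α ≡ powerSum β → ∀ i → α i ≡ β i
  powerSum-injective zero    _   _ _ _  _  _    ()
  powerSum-injective (suc n) n<q α β α↑ β↑ sum≡ i with view i
  ... | ‵fromℕ     = powerSum-last-unique n α β n<q α↑ β↑ sum≡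
  ... | ‵inject₁ j = powerSum-injective n (<⇒≤ n<q) (α ∘ inject₁) (β ∘ inject₁)
                       (Sorted-init α↑) (Sorted-init β↑)
                       (sumFin-cancel-last n (λ k → q ^ α k) (λ k → q ^ β k) (cong (q ^_) last≡) sum≡) j
    where
      last≡ : α (fromℕ n) ≡ β (fromℕ n)
      last≡ = powerSum-last-unique n α β n<q α↑ β↑ sum≡

  S-length-unique : ∀ {t t′} {α : Fin t → ℕ} {β : Fin t′ → ℕ} →
                    (∀ i → 1 ≤ α i) → (∀ i → 1 ≤ β i) → 1 ≤ t → t ≤ q → 1 ≤ t′ → t′ ≤ q →
                    S q t α ≡ S q t′ β → t ≡ t′
  S-length-unique {t} {t′} α≥1 β≥1 1≤t t≤q 1≤t′ t′≤q S≡ =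
    ∣-offset-unique (∣S+n t α≥1) (subst (λ s → q ∣ s + t′) (sym S≡) (∣S+n t′ β≥1)) 1≤t t≤q 1≤t′ t′≤q

  S-injective : ∀ n → n ≤ q → (α β : Fin n → ℕ) → Sorted α → Sorted β →
                S q n α ≡ S q n β → ∀ i → α i ≡ β i
  S-injective n n≤q α β α↑ β↑ S≡ = powerSum-injective n n≤q α β α↑ β↑ (begin
    powerSum α   ≡⟨ S+n≡powerSum n α ⟨
    S q n α + n  ≡⟨ cong (_+ n) S≡ ⟩
    S q n β + n  ≡⟨ S+n≡powerSum n β ⟩
    powerSum β   ∎)
    where open ≡-Reasoning

open PowerSums

prime-power>1 : ∀ {q} → IsPrimePower q → 1 < q
prime-power>1 (p , k , p-prime , 1≤k , refl) =
  <-≤-trans (nonTrivial⇒n>1 p {{prime⇒nonTrivial p-prime}})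
            (subst (_≤ p ^ k) (^-identityʳ p) (^-monoʳ-≤ p {{prime⇒nonZero p-prime}} 1≤k))

lemma3p9 : (q : ℕ) → IsPrimePower q → (t t′ : ℕ) → 1 ≤ t → t ≤ q → 1 ≤ t′ → t′ ≤ q →
    (α : Fin t → ℕ) → (β : Fin t′ → ℕ) →
    (∀ i → 1 ≤ α i) → (∀ i j → i ≤ᶠ j → α i ≤ α j) →
    (∀ i → 1 ≤ β i) → (∀ i j → i ≤ᶠ j → β i ≤ β j) →
    S q t α ≡ S q t′ β →
    Σ (t ≡ t′) (λ e → ∀ i → α i ≡ β (cast e i))
lemma3p9 q q-pp t t′ 1≤t t≤q 1≤t′ t′≤q α β α≥1 α↑ β≥1 β↑ S≡
  with S-length-unique (prime-power>1 q-pp) α≥1 β≥1 1≤t t≤q 1≤t′ t′≤q S≡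
... | refl = refl , λ i → begin
  α i              ≡⟨ S-injective (prime-power>1 q-pp) t t≤q α β α↑ β↑ S≡ i ⟩
  β i              ≡⟨ cong β (cast-is-id refl i) ⟨
  β (cast refl i)  ∎
  where open ≡-Reasoning
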